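{- Let $G$ be a cograph and let $C$ be its cotree, regarded as an element of $\mathbb{T}$ by forgetting the labels $0/1$ of internal nodes and the identities of the leaves. Then there is exactly one ordered tree associated with $G$; that is, any two ordered trees whose underlying rooted trees are isomorphic to $C$ are identical as ordered trees (there is an isomorphism between them preserving the root, the parent relation and the arrangement of the children of every node).
   Context: A cograph is a $P_4$-free graph (equivalently, a graph obtained from single vertices by disjoint unions and complementations). A cotree of a cograph $G$ is a rooted tree whose leaves are the vertices of $G$, whose internal nodes each have at least two children and are labeled $0$ or $1$, with labels alternating along every root-to-leaf path (an internal node and an internal child of it have different labels), such that two vertices of $G$ are adjacent if and only if their lowest common ancestor is labeled $1$. Every cograph has a cotree, unique up to isomorphism. Let $\mathbb{T}$ be the set of finite rooted trees in which every internal node has at least two children. For a node $v$, $T(v)$ is the subtree rooted at $v$ and $l(v)$ the number of leaves of $T(v)$. For an integer $p\ge 2$, $\mathrm{Part}(p)$ is the set of non-decreasing sequences $(a_1,\dots,a_k)$ of positive integers with $k\ge 2$ and $\sum_i a_i=p$, ordered lexicographically: for distinct $a=(a_i)_k$, $b=(b_i)_m$, let $j$ be the least index $\le\min\{k,m\}$ with $a_j\ne b_j$; then $a<b$ iff $a_j<b_j$. Node comparison: define, by induction on the number of leaves, a comparison between nodes $v,w$ with outcomes $v<w$, $v\sim w$, or $w<v$: (1) if $l(v)<l(w)$ then $v<w$ (symmetrically if $l(w)<l(v)$); (2) if $l(v)=l(w)=1$ then $v\sim w$; (3) if $l(v)=l(w)\ge 2$, list the children of $v$ as $v_1,\dots,v_k$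 and those of $w$ as $w_1,\dots,w_m$, each list non-decreasing with respect to this comparison (already defined for them); the sequences $(l(v_1),\dots,l(v_k))$, $(l(w_1),\dots,l(w_m))\in\mathrm{Part}(l(v))$ are the partitions induced by $v$ and $w$. (3.1) If the partition induced by $v$ is lexicographically smaller (resp. larger) than the one induced by $w$ then $v<w$ (resp. $w<v$). (3.2) If they are equal (so $k=m$): if $v_i\sim w_i$ for all $i$ then $v\sim w$; otherwise, with $j$ least such that $v_j\not\sim w_j$, $v<w$ if $v_j<w_j$ and $w<v$ otherwise. Write $v\le w$ if $v<w$ or $v\sim w$. An ordered tree is a tree $T\in\mathbb{T}$ together with, for every internal node, an arrangement of its children as a sequence $v_1,\dots,v_k$ such that $v_1\le v_2\le\dots\le v_k$. -}

module Defs where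

open import Data.Nat using (ℕ; zero; suc; _+_; _≤_)
open import Data.Bool using (Bool; true; false)
open import Data.Maybe using (Maybe; just; nothing)
open import Data.Fin using (Fin)
open import Data.List using (List; []; _∷_; length; map; foldr; lookup; allFin)
open import Data.List.Relation.Unary.All using (All)
open import Data.List.Relation.Unary.Any using (Any)
open import Data.List.Relation.Unary.Linked using (Linked)
open import Data.List.Relation.Binary.Pointwise using (Pointwise)
open import Data.List.Relation.Binary.Permutation.Propositional using (_↭_)
open import Data.List.Membership.Propositional using (_∈_)
open import Data.Product using (_×_; ∃)
open import Relation.Nullary using (¬_)
open import Relation.Binary.PropositionalEquality using (_≡_; _≢_)

-- Rooted trees (children given as a list; as an unordered tree the
-- list order is irrelevant, as an ordered tree it is the arrangement).

data Tree : Set where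
  leaf : Tree
  node : List Tree → Tree

mutual
  nLeaves : Tree → ℕ
  nLeaves leaf = 1
  nLeaves (node ts) = nLeavesL ts

  nLeavesL : List Tree → ℕ
  nLeavesL [] = 0
  nLeavesL (t ∷ ts) = nLeaves t + nLeavesL ts

data InT : Tree → Set where
  leaf : InT leaf
  node : ∀ {ts} → 2 ≤ length ts → All InT ts → InT (node ts)

data _≅_ : Tree → Tree → Set where
  leaf : leaf ≅ leaf
  node : ∀ {ts vs us} → Pointwise _≅_ ts vs → vs ↭ us → node ts ≅ node us

data Cmp : Set where
  lt eq gt : Cmp

cmpℕ : ℕ → ℕ → Cmp
cmpℕ zero zero = eq
cmpℕ zero (suc _) = lt
cmpℕ (suc _) zero = gt
cmpℕ (suc m) (suc n) = cmpℕ m n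

lexℕ : List ℕ → List ℕ → Cmp
lexℕ [] [] = eq
lexℕ [] (_ ∷ _) = lt
lexℕ (_ ∷ _) [] = gt
lexℕ (a ∷ as) (b ∷ bs) with cmpℕ a b
... | lt = lt
... | gt = gt
... | eq = lexℕ as bs

lexWith : {A : Set} → (A → A → Cmp) → List A → List A → Cmp
lexWith c [] [] = eq
lexWith c [] (_ ∷ _) = lt
lexWith c (_ ∷ _) [] = gt
lexWith c (x ∷ xs) (y ∷ ys) with c x y
... | lt = lt
... | gt = gt
... | eq = lexWith c xs ys

insertBy : {A : Set} → (A → A → Cmp) → A → List A → List A
insertBy c x [] = x ∷ []
insertBy c x (y ∷ ys) with c x y
... | gt = y ∷ insertBy c x ys
... | _ = x ∷ y ∷ ys

sortBy : {A : Set} → (A → A → Cmp) → List A → List A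
sortBy c = foldr (insertBy c) []

-- comparison with fuel (the paper's induction on the number of leaves)
mutual
  cmpF : ℕ → Tree → Tree → Cmp
  cmpF f v w with cmpℕ (nLeaves v) (nLeaves w)
  ... | lt = lt
  ... | gt = gt
  ... | eq = sameSize f v w

  sameSize : ℕ → Tree → Tree → Cmp
  sameSize _ leaf leaf = eq
  sameSize zero _ _ = eq
  sameSize (suc f) (node vs) (node ws) with lexℕ (map nLeaves (sortBy (cmpF f) vs))
                                                  (map nLeaves (sortBy (cmpF f) ws))
  ... | lt = lt
  ... | gt = gt
  ... | eq = lexWith (cmpF f) (sortBy (cmpF f) vs) (sortBy (cmpF f) ws)
  -- unreachable for trees in 𝕋 with equal leaf counts
  sameSize (suc f) leaf (node _) = eq
  sameSize (suc f) (node _) leaf = eq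

-- fuel l(v) suffices: children have strictly fewer leaves
compareT : Tree → Tree → Cmp
compareT v w = cmpF (nLeaves v) v w

_≤T_ : Tree → Tree → Set
v ≤T w = compareT v w ≢ gt

data Ordered : Tree → Set where
  leaf : Ordered leaf
  node : ∀ {ts} → All Ordered ts → Linked _≤T_ ts → Ordered (node ts)

OrderedTree : Tree → Set
OrderedTree t = InT t × Ordered t

record Graph (n : ℕ) : Set₁ where
  field
    Adj    : Fin n → Fin n → Set
    sym    : ∀ {u v} → Adj u v → Adj v u
    irrefl : ∀ {u} → ¬ Adj u u

-- P4-free (distinctness of the four vertices is forced by the pattern)
Cograph : ∀ {n} → Graph n → Set
Cograph G = ¬ (∃ λ a → ∃ λ b → ∃ λ c → ∃ λ d →
    Adj a b × Adj b c × Adj c d × ¬ Adj a c × ¬ Adj b d × ¬ Adj a d)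
  where open Graph G

-- labelled cotree: leaves carry vertices, internal nodes a label (true = 1)
data CoTree (n : ℕ) : Set where
  cleaf : Fin n → CoTree n
  cnode : Bool → List (CoTree n) → CoTree n

mutual
  leavesC : ∀ {n} → CoTree n → List (Fin n)
  leavesC (cleaf x) = x ∷ []
  leavesC (cnode _ ts) = leavesCL ts

  leavesCL : ∀ {n} → List (CoTree n) → List (Fin n)
  leavesCL [] = []
  leavesCL (t ∷ ts) = Data.List._++_ (leavesC t) (leavesCL ts)

labelOf : ∀ {n} → CoTree n → Maybe Bool
labelOf (cleaf _) = nothing
labelOf (cnode b _) = just b

data WFCoTree {n} : CoTree n → Set where
  cleaf : ∀ {x} → WFCoTree (cleaf x)
  cnode : ∀ {b ts} → 2 ≤ length ts → All (λ t → labelOf t ≢ just b) ts →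
          All WFCoTree ts → WFCoTree (cnode b ts)

-- Lca C u v b : the lowest common ancestor of leaves u, v in C has label b
data Lca {n} : CoTree n → Fin n → Fin n → Bool → Set where
  here  : ∀ {b ts u v} (i j : Fin (length ts)) → i ≢ j →
          u ∈ leavesC (lookup ts i) → v ∈ leavesC (lookup ts j) →
          Lca (cnode b ts) u v b
  there : ∀ {b c ts u v} → Any (λ t → Lca t u v c) ts → Lca (cnode b ts) u v c

IsCotree : ∀ {n} → Graph n → CoTree n → Set
IsCotree {n} G C =
  WFCoTree C × (leavesC C ↭ allFin n) ×
  (∀ u v → u ≢ v → (Adj u v → Lca C u v true) × (Lca C u v true → Adj u v))
  where open Graph G

mutual
  forget : ∀ {n} → CoTree n → Tree
  forget (cleaf _) = leaf
  forget (cnode _ ts) = node (forgetL ts)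

  forgetL : ∀ {n} → List (CoTree n) → List Tree
  forgetL [] = []
  forgetL (t ∷ ts) = forget t ∷ forgetL ts

-- Sorting the children of every node, bottom-up, by a structural total order cmpTree gives a
-- canonical form of a rooted tree; isomorphic trees have equal canonical forms because sorting
-- lists that are permutations of each other gives the same list. On trees of 𝕋 the paper's node
-- comparison of two trees is cmpTree applied to their canonical forms, so at every node of an
-- ordered tree the children are already sorted for cmpTree: an ordered tree is its own canonical
-- form. Two ordered trees isomorphic to the same cotree therefore coincide.
module Submission where

open import Data.Empty using (⊥-elim)
open import Data.List using (List; []; _∷_; map)
open import Data.List.Properties using (map-∘; map-cong)
open import Data.List.Relation.Binary.Permutation.Propositional
  using (_↭_; prep; swap; ↭-refl; ↭-trans; ↭-sym; ↭⇒↭ₛ)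
open import Data.List.Relation.Binary.Permutation.Propositional.Properties
  using (All-resp-↭; map⁺)
open import Data.List.Relation.Binary.Pointwise using (Pointwise; []; _∷_; Pointwise-≡⇒≡)
open import Data.List.Relation.Unary.All as All using (All; []; _∷_)
open import Data.List.Relation.Unary.Linked using (Linked; []; [-]; _∷_)
import Data.List.Relation.Unary.Sorted.TotalOrder.Properties as Sortedₚ
import Data.List.Sort.InsertionSort.Base as InsertionSort
import Data.List.Sort.InsertionSort.Properties as InsertionSortₚ
open import Data.Nat using (ℕ; zero; suc; _+_; _≤_; _<_; z≤n; s≤s)
open import Data.Nat.ListAction using (sum)
open import Data.Nat.ListAction.Properties using (sum-↭)
open import Data.Nat.Properties
  using (≤-refl; ≤-trans; <-irrefl; ≤-<-trans; <-≤-trans; m≤m+n; m≤n+m; m<m+n; m<n+m; m<1+n⇒m≤n)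
open import Data.Product using (_×_; _,_; proj₂)
open import Data.Sum using (_⊎_; inj₁; inj₂)
open import Relation.Binary.Bundles using (DecTotalOrder)
open import Relation.Binary.PropositionalEquality
  using (_≡_; _≢_; refl; sym; trans; cong; cong₂; subst; subst₂; isEquivalence; module ≡-Reasoning)
open import Relation.Nullary using (Dec; yes; no)

open import Defs

flipC : Cmp → Cmp
flipC lt = gt
flipC eq = eq
flipC gt = lt

thenC : Cmp → Cmp → Cmp
thenC lt _ = lt
thenC eq d = d
thenC gt _ = gt

thenC-flip : ∀ c d → thenC (flipC c) (flipC d) ≡ flipC (thenC c d)
thenC-flip lt d = refl
thenC-flip eq d = refl
thenC-flip gt d = refl

thenC-eq : ∀ {c d} → thenC c d ≡ eq → c ≡ eq × d ≡ eq
thenC-eq {eq} e = refl , e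

thenC-congʳ : ∀ c {d d′} → (c ≡ eq → d ≡ d′) → thenC c d ≡ thenC c d′
thenC-congʳ lt _ = refl
thenC-congʳ eq h = h refl
thenC-congʳ gt _ = refl

thenC-lt : ∀ {c} d → c ≡ lt → thenC c d ≡ lt
thenC-lt d refl = refl

thenC-lt-trans : ∀ {A : Set} (c : A → A → Cmp) {x y z d₁ d₂ d₃} →
  (c x y ≡ eq → x ≡ y) → (c y z ≡ eq → y ≡ z) →
  (c x y ≡ lt → c y z ≡ lt → c x z ≡ lt) → (d₁ ≡ lt → d₂ ≡ lt → d₃ ≡ lt) →
  thenC (c x y) d₁ ≡ lt → thenC (c y z) d₂ ≡ lt → thenC (c x z) d₃ ≡ lt
-- The `with` also rewrites c x y and c y z in the types of the hypotheses, hence the refl's.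
thenC-lt-trans c {x} {y} {z} {d₁} {d₂} {d₃} x≡y-if y≡z-if c-lt-trans d-lt-trans p q
  with c x y in e₁ | c y z in e₂
... | lt | lt = thenC-lt d₃ (c-lt-trans refl refl)
... | lt | eq = thenC-lt d₃ (trans (cong (c x) (sym (y≡z-if refl))) e₁)
... | eq | lt = thenC-lt d₃ (trans (cong (λ a → c a z) (x≡y-if refl)) e₂)
... | eq | eq rewrite trans (cong (λ a → c a z) (x≡y-if refl)) e₂ = d-lt-trans p q

record IsComparison {A : Set} (c : A → A → Cmp) : Set where
  field
    eq⇒≡     : ∀ {x y} → c x y ≡ eq → x ≡ y
    flips    : ∀ x y → c y x ≡ flipC (c x y)
    lt-trans : ∀ {x y z} → c x y ≡ lt → c y z ≡ lt → c x z ≡ lt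

thenC-lt-trans-by : ∀ {A : Set} {c : A → A → Cmp} → IsComparison c → ∀ {x y z d₁ d₂ d₃} →
  (d₁ ≡ lt → d₂ ≡ lt → d₃ ≡ lt) →
  thenC (c x y) d₁ ≡ lt → thenC (c y z) d₂ ≡ lt → thenC (c x z) d₃ ≡ lt
thenC-lt-trans-by {c = c} isCmp {x} {y} {z} =
  thenC-lt-trans c eq⇒≡ eq⇒≡ (lt-trans {x} {y} {z})
  where open IsComparison isCmp

isComparison-resp : ∀ {A : Set} {c d : A → A → Cmp} →
  (∀ x y → c x y ≡ d x y) → IsComparison c → IsComparison d
isComparison-resp {c = c} {d} c≗d isCmp = record
  { eq⇒≡     = λ e → eq⇒≡ (trans (c≗d _ _) e)
  ; flips    = λ x y → trans (sym (c≗d y x)) (trans (flips x y) (cong flipC (c≗d x y)))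
  ; lt-trans = λ p q → trans (sym (c≗d _ _)) (lt-trans (trans (c≗d _ _) p) (trans (c≗d _ _) q))
  }
  where open IsComparison isCmp

cmpℕ-isComparison : IsComparison cmpℕ
cmpℕ-isComparison = record
  { eq⇒≡ = eq⇒≡ _ _ ; flips = flips ; lt-trans = λ {m} {n} {o} → lt-trans m n o }
  where
    eq⇒≡ : ∀ m n → cmpℕ m n ≡ eq → m ≡ n
    eq⇒≡ zero    zero    _ = refl
    eq⇒≡ (suc m) (suc n) e = cong suc (eq⇒≡ m n e)

    flips : ∀ m n → cmpℕ n m ≡ flipC (cmpℕ m n)
    flips zero    zero    = refl
    flips zero    (suc n) = refl
    flips (suc m) zero    = refl
    flips (suc m) (suc n) = flips m n

    lt-trans : ∀ m n o → cmpℕ m n ≡ lt → cmpℕ n o ≡ lt → cmpℕ m o ≡ lt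
    lt-trans zero    (suc n) (suc o) _ _ = refl
    lt-trans (suc m) (suc n) (suc o) p q = lt-trans m n o p q

lexWith-unfold : ∀ {A : Set} (c : A → A → Cmp) x y xs ys →
  lexWith c (x ∷ xs) (y ∷ ys) ≡ thenC (c x y) (lexWith c xs ys)
lexWith-unfold c x y xs ys with c x y
... | lt = refl
... | eq = refl
... | gt = refl

lexWith-isComparison : ∀ {A : Set} {c : A → A → Cmp} → IsComparison c → IsComparison (lexWith c)
lexWith-isComparison {c = c} isCmp =
  record
    { eq⇒≡ = lex-eq⇒≡ _ _ ; flips = lex-flips ; lt-trans = λ {xs} {ys} {zs} → lex-lt-trans xs ys zs }
  where
    open IsComparison isCmp
    open ≡-Reasoning

    lex-eq⇒≡ : ∀ xs ys → lexWith c xs ys ≡ eq → xs ≡ ys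
    lex-eq⇒≡ []       []       _ = refl
    lex-eq⇒≡ (x ∷ xs) (y ∷ ys) e =
      let e₁ , e₂ = thenC-eq (trans (sym (lexWith-unfold c x y xs ys)) e)
      in cong₂ _∷_ (eq⇒≡ e₁) (lex-eq⇒≡ xs ys e₂)

    lex-flips : ∀ xs ys → lexWith c ys xs ≡ flipC (lexWith c xs ys)
    lex-flips []       []       = refl
    lex-flips []       (_ ∷ _)  = refl
    lex-flips (_ ∷ _)  []       = refl
    lex-flips (x ∷ xs) (y ∷ ys) = begin
      lexWith c (y ∷ ys) (x ∷ xs)                  ≡⟨ lexWith-unfold c y x ys xs ⟩
      thenC (c y x) (lexWith c ys xs)              ≡⟨ cong₂ thenC (flips x y) (lex-flips xs ys) ⟩
      thenC (flipC (c x y)) (flipC (lexWith c xs ys)) ≡⟨ thenC-flip (c x y) (lexWith c xs ys) ⟩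
      flipC (thenC (c x y) (lexWith c xs ys))      ≡⟨ cong flipC (lexWith-unfold c x y xs ys) ⟨
      flipC (lexWith c (x ∷ xs) (y ∷ ys))          ∎

    lex-lt-trans : ∀ xs ys zs → lexWith c xs ys ≡ lt → lexWith c ys zs ≡ lt → lexWith c xs zs ≡ lt
    lex-lt-trans []       []       []       ()
    lex-lt-trans []       (_ ∷ _)  []       _ ()
    lex-lt-trans []       _        (_ ∷ _)  _ _ = refl
    lex-lt-trans (x ∷ xs) (y ∷ ys) (z ∷ zs) p q =
      trans (lexWith-unfold c x z xs zs)
        (thenC-lt-trans-by isCmp (lex-lt-trans xs ys zs)
          (trans (sym (lexWith-unfold c x y xs ys)) p)
          (trans (sym (lexWith-unfold c y z ys zs)) q))

lexWith-cmpℕ≗lexℕ : ∀ as bs → lexWith cmpℕ as bs ≡ lexℕ as bs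
lexWith-cmpℕ≗lexℕ []       []       = refl
lexWith-cmpℕ≗lexℕ []       (_ ∷ _)  = refl
lexWith-cmpℕ≗lexℕ (_ ∷ _)  []       = refl
lexWith-cmpℕ≗lexℕ (a ∷ as) (b ∷ bs) with cmpℕ a b
... | lt = refl
... | eq = lexWith-cmpℕ≗lexℕ as bs
... | gt = refl

lexℕ-isComparison : IsComparison lexℕ
lexℕ-isComparison = isComparison-resp lexWith-cmpℕ≗lexℕ (lexWith-isComparison cmpℕ-isComparison)

insertBy-↭ : ∀ {A : Set} (c : A → A → Cmp) x ys → insertBy c x ys ↭ x ∷ ys
insertBy-↭ c x []       = ↭-refl
insertBy-↭ c x (y ∷ ys) with c x y
... | lt = ↭-refl
... | eq = ↭-refl
... | gt = ↭-trans (prep y (insertBy-↭ c x ys)) (swap y x ↭-refl)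

sortBy-↭ : ∀ {A : Set} (c : A → A → Cmp) xs → sortBy c xs ↭ xs
sortBy-↭ c []       = ↭-refl
sortBy-↭ c (x ∷ xs) = ↭-trans (insertBy-↭ c x (sortBy c xs)) (prep x (sortBy-↭ c xs))

All-sortBy : ∀ {A : Set} {P : A → Set} {c : A → A → Cmp} {xs} → All P xs → All P (sortBy c xs)
All-sortBy {c = c} {xs} = All-resp-↭ (↭-sym (sortBy-↭ c xs))

module SortBy {A : Set} {c : A → A → Cmp} (isCmp : IsComparison c) where
  open IsComparison isCmp

  _≼_ : A → A → Set
  x ≼ y = c x y ≢ gt

  c-refl : ∀ x → c x x ≡ eq
  c-refl x with c x x | flips x x
  ... | eq | _ = refl

  ≼-by : ∀ {x y k} → c x y ≡ k → k ≢ gt → x ≼ y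
  ≼-by e k≢gt e′ = k≢gt (trans (sym e) e′)

  ≼-reflexive : ∀ {x y} → x ≡ y → x ≼ y
  ≼-reflexive {x} refl = ≼-by (c-refl x) (λ ())

  ≼-view : ∀ {x y} → x ≼ y → c x y ≡ lt ⊎ x ≡ y
  ≼-view {x} {y} x≼y with c x y in e
  ... | lt = inj₁ refl
  ... | eq = inj₂ (eq⇒≡ e)
  ... | gt = ⊥-elim (x≼y refl)

  ≼-trans : ∀ {x y z} → x ≼ y → y ≼ z → x ≼ z
  ≼-trans x≼y y≼z with ≼-view x≼y | ≼-view y≼z
  ... | inj₁ x<y  | inj₁ y<z  = ≼-by (lt-trans x<y y<z) (λ ())
  ... | inj₂ refl | _         = y≼z
  ... | inj₁ _    | inj₂ refl = x≼y

  ≼-antisym : ∀ {x y} → x ≼ y → y ≼ x → x ≡ y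
  ≼-antisym {x} {y} x≼y y≼x with ≼-view x≼y
  ... | inj₁ x<y = ⊥-elim (y≼x (trans (flips x y) (cong flipC x<y)))
  ... | inj₂ x≡y = x≡y

  ≢gt? : ∀ k → Dec (k ≢ gt)
  ≢gt? lt = yes (λ ())
  ≢gt? eq = yes (λ ())
  ≢gt? gt = no (λ k≢gt → k≢gt refl)

  decTotalOrder : DecTotalOrder _ _ _
  decTotalOrder = record
    { Carrier = A
    ; _≈_ = _≡_
    ; _≤_ = _≼_
    ; isDecTotalOrder = record
      { isTotalOrder = record
        { isPartialOrder = record
          { isPreorder = record
            { isEquivalence = isEquivalence ; reflexive = ≼-reflexive ; trans = ≼-trans }
          ; antisym = ≼-antisym
          }
        ; total = total
        }
      ; _≟_ = λ x y → ≡? x y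
      ; _≤?_ = λ x y → ≢gt? (c x y)
      }
    }
    where
      total : ∀ x y → x ≼ y ⊎ y ≼ x
      total x y with c x y in e
      ... | lt = inj₁ (λ ())
      ... | eq = inj₁ (λ ())
      ... | gt = inj₂ (≼-by (trans (flips x y) (cong flipC e)) (λ ()))

      ≡? : ∀ x y → Dec (x ≡ y)
      ≡? x y with ≢gt? (c x y) | ≢gt? (c y x)
      ... | yes x≼y | yes y≼x = yes (≼-antisym x≼y y≼x)
      ... | no x⋠y  | _       = no (λ x≡y → x⋠y (≼-reflexive x≡y))
      ... | _       | no y⋠x  = no (λ x≡y → y⋠x (≼-reflexive (sym x≡y)))

  open InsertionSort decTotalOrder using (insert; sort)

  sortBy≗sort : ∀ xs → sortBy c xs ≡ sort xs
  sortBy≗sort []       = refl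
  sortBy≗sort (x ∷ xs) rewrite sortBy≗sort xs = insertBy≗insert (sort xs)
    where
      insertBy≗insert : ∀ ys → insertBy c x ys ≡ insert x ys
      insertBy≗insert []       = refl
      insertBy≗insert (y ∷ ys) with c x y
      ... | lt = refl
      ... | eq = refl
      ... | gt = cong (y ∷_) (insertBy≗insert ys)

  sortBy-sorted : ∀ xs → Linked _≼_ (sortBy c xs)
  sortBy-sorted xs rewrite sortBy≗sort xs = InsertionSortₚ.sort-↗ decTotalOrder xs

  sorted-unique : ∀ {xs ys} → Linked _≼_ xs → Linked _≼_ ys → xs ↭ ys → xs ≡ ys
  sorted-unique xs↗ ys↗ xs↭ys =
    Pointwise-≡⇒≡ (Sortedₚ.↗↭↗⇒≋ (DecTotalOrder.totalOrder decTotalOrder) xs↗ ys↗ (↭⇒↭ₛ xs↭ys))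

  sortBy-↭-invariant : ∀ {xs ys} → xs ↭ ys → sortBy c xs ≡ sortBy c ys
  sortBy-↭-invariant {xs} {ys} xs↭ys = sorted-unique (sortBy-sorted xs) (sortBy-sorted ys)
    (↭-trans (sortBy-↭ c xs) (↭-trans xs↭ys (↭-sym (sortBy-↭ c ys))))

  sortBy-of-sorted : ∀ {xs} → Linked _≼_ xs → sortBy c xs ≡ xs
  sortBy-of-sorted {xs} xs↗ = sorted-unique (sortBy-sorted xs) xs↗ (sortBy-↭ c xs)

module _ {A B : Set} {P : A → Set} (f : A → B) {c : A → A → Cmp} {d : B → B → Cmp}
         (c≗d : ∀ {x y} → P x → P y → c x y ≡ d (f x) (f y)) where

  insertBy-map : ∀ {x ys} → P x → All P ys → map f (insertBy c x ys) ≡ insertBy d (f x) (map f ys)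
  insertBy-map {x} {[]}     _  _          = refl
  insertBy-map {x} {y ∷ ys} px (py ∷ pys) rewrite c≗d px py with d (f x) (f y)
  ... | lt = refl
  ... | eq = refl
  ... | gt = cong (f y ∷_) (insertBy-map px pys)

  sortBy-map : ∀ {xs} → All P xs → map f (sortBy c xs) ≡ sortBy d (map f xs)
  sortBy-map {[]}     []         = refl
  sortBy-map {x ∷ xs} (px ∷ pxs) =
    trans (insertBy-map px (All-sortBy pxs))
          (cong (insertBy d (f x)) (sortBy-map pxs))

  lexWith-map : ∀ {xs ys} → All P xs → All P ys → lexWith c xs ys ≡ lexWith d (map f xs) (map f ys)
  lexWith-map {[]}     {[]}     _          _          = refl
  lexWith-map {[]}     {_ ∷ _}  _          _          = refl
  lexWith-map {_ ∷ _}  {[]}     _          _          = refl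
  lexWith-map {x ∷ xs} {y ∷ ys} (px ∷ pxs) (py ∷ pys) =
    trans (lexWith-unfold c x y xs ys)
      (trans (cong₂ thenC (c≗d px py) (lexWith-map pxs pys))
             (sym (lexWith-unfold d (f x) (f y) (map f xs) (map f ys))))

Linked-map-All : ∀ {A : Set} {P : A → Set} {R S : A → A → Set} →
  (∀ {x y} → P x → P y → R x y → S x y) → ∀ {xs} → All P xs → Linked R xs → Linked S xs
Linked-map-All R⇒S _                []        = []
Linked-map-All R⇒S _                [-]       = [-]
Linked-map-All R⇒S (px ∷ py ∷ pxs) (r ∷ rs)  = R⇒S px py r ∷ Linked-map-All R⇒S (py ∷ pxs) rs

nLeavesL≗sum : ∀ ts → nLeavesL ts ≡ sum (map nLeaves ts)
nLeavesL≗sum []       = refl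
nLeavesL≗sum (t ∷ ts) = cong (nLeaves t +_) (nLeavesL≗sum ts)

nLeavesL-↭ : ∀ {ts us} → ts ↭ us → nLeavesL ts ≡ nLeavesL us
nLeavesL-↭ {ts} {us} ts↭us =
  trans (nLeavesL≗sum ts) (trans (sum-↭ (map⁺ nLeaves ts↭us)) (sym (nLeavesL≗sum us)))

nLeaves≤nLeavesL : ∀ ts → All (λ t → nLeaves t ≤ nLeavesL ts) ts
nLeaves≤nLeavesL []       = []
nLeaves≤nLeavesL (t ∷ ts) =
  m≤m+n _ _ ∷ All.map (λ t≤ → ≤-trans t≤ (m≤n+m _ (nLeaves t))) (nLeaves≤nLeavesL ts)

0<nLeaves : ∀ {t} → InT t → 0 < nLeaves t
0<nLeaves leaf                 = s≤s z≤n
0<nLeaves (node _ (it ∷ _))    = ≤-trans (0<nLeaves it) (m≤m+n _ _)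

nLeaves-child< : ∀ {ts} → InT (node ts) → All (λ t → nLeaves t < nLeavesL ts) ts
nLeaves-child< (node _ (ia ∷ ib ∷ _)) =
  m<m+n _ (≤-trans (0<nLeaves ib) (m≤m+n _ _)) ∷
  All.map (λ t≤ → ≤-<-trans t≤ (m<n+m _ (0<nLeaves ia))) (nLeaves≤nLeavesL _)
nLeaves-child< (node (s≤s ()) (_ ∷ []))

1<nLeaves-node : ∀ {ts} → InT (node ts) → 1 < nLeavesL ts
1<nLeaves-node i@(node _ (it ∷ _)) with nLeaves-child< i
... | t< ∷ _ = ≤-<-trans (0<nLeaves it) t<

mutual
  cmpTree : Tree → Tree → Cmp
  cmpTree v w = thenC (cmpℕ (nLeaves v) (nLeaves w)) (cmpShape v w)

  cmpShape : Tree → Tree → Cmp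
  cmpShape leaf      leaf      = eq
  cmpShape leaf      (node _)  = lt
  cmpShape (node _)  leaf      = gt
  cmpShape (node vs) (node ws) = thenC (lexℕ (map nLeaves vs) (map nLeaves ws)) (cmpForest vs ws)

  cmpForest : List Tree → List Tree → Cmp
  cmpForest []       []       = eq
  cmpForest []       (_ ∷ _)  = lt
  cmpForest (_ ∷ _)  []       = gt
  cmpForest (v ∷ vs) (w ∷ ws) = thenC (cmpTree v w) (cmpForest vs ws)

cmpForest≗lexWith : ∀ vs ws → cmpForest vs ws ≡ lexWith cmpTree vs ws
cmpForest≗lexWith []       []       = refl
cmpForest≗lexWith []       (_ ∷ _)  = refl
cmpForest≗lexWith (_ ∷ _)  []       = refl
cmpForest≗lexWith (v ∷ vs) (w ∷ ws) =
  trans (cong (thenC (cmpTree v w)) (cmpForest≗lexWith vs ws))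
        (sym (lexWith-unfold cmpTree v w vs ws))

module _ where
  private
    module Nat = IsComparison cmpℕ-isComparison
    module Lex = IsComparison lexℕ-isComparison

  mutual
    cmpTree-eq⇒≡ : ∀ v w → cmpTree v w ≡ eq → v ≡ w
    cmpTree-eq⇒≡ v w e = cmpShape-eq⇒≡ v w (proj₂ (thenC-eq e))

    cmpShape-eq⇒≡ : ∀ v w → cmpShape v w ≡ eq → v ≡ w
    cmpShape-eq⇒≡ leaf      leaf      _ = refl
    cmpShape-eq⇒≡ (node vs) (node ws) e = cong node (cmpForest-eq⇒≡ vs ws (proj₂ (thenC-eq e)))

    cmpForest-eq⇒≡ : ∀ vs ws → cmpForest vs ws ≡ eq → vs ≡ ws
    cmpForest-eq⇒≡ []       []       _ = refl
    cmpForest-eq⇒≡ (v ∷ vs) (w ∷ ws) e =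
      let e₁ , e₂ = thenC-eq e in cong₂ _∷_ (cmpTree-eq⇒≡ v w e₁) (cmpForest-eq⇒≡ vs ws e₂)

  mutual
    cmpTree-flips : ∀ v w → cmpTree w v ≡ flipC (cmpTree v w)
    cmpTree-flips v w = trans (cong₂ thenC (Nat.flips (nLeaves v) (nLeaves w)) (cmpShape-flips v w))
                              (thenC-flip _ (cmpShape v w))

    cmpShape-flips : ∀ v w → cmpShape w v ≡ flipC (cmpShape v w)
    cmpShape-flips leaf      leaf      = refl
    cmpShape-flips leaf      (node _)  = refl
    cmpShape-flips (node _)  leaf      = refl
    cmpShape-flips (node vs) (node ws) =
      trans (cong₂ thenC (Lex.flips (map nLeaves vs) (map nLeaves ws)) (cmpForest-flips vs ws))
            (thenC-flip _ (cmpForest vs ws))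

    cmpForest-flips : ∀ vs ws → cmpForest ws vs ≡ flipC (cmpForest vs ws)
    cmpForest-flips []       []       = refl
    cmpForest-flips []       (_ ∷ _)  = refl
    cmpForest-flips (_ ∷ _)  []       = refl
    cmpForest-flips (v ∷ vs) (w ∷ ws) =
      trans (cong₂ thenC (cmpTree-flips v w) (cmpForest-flips vs ws))
            (thenC-flip _ (cmpForest vs ws))

  mutual
    cmpTree-lt-trans : ∀ u v w → cmpTree u v ≡ lt → cmpTree v w ≡ lt → cmpTree u w ≡ lt
    cmpTree-lt-trans u v w =
      thenC-lt-trans-by cmpℕ-isComparison {nLeaves u} {nLeaves v} {nLeaves w}
        (cmpShape-lt-trans u v w)

    cmpShape-lt-trans : ∀ u v w → cmpShape u v ≡ lt → cmpShape v w ≡ lt → cmpShape u w ≡ lt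
    cmpShape-lt-trans leaf      leaf      _         ()
    cmpShape-lt-trans leaf      (node _)  leaf      _ ()
    cmpShape-lt-trans leaf      (node _)  (node _)  _ _ = refl
    cmpShape-lt-trans (node _)  leaf      _         ()
    cmpShape-lt-trans (node _)  (node _)  leaf      _ ()
    cmpShape-lt-trans (node us) (node vs) (node ws) =
      thenC-lt-trans-by lexℕ-isComparison {map nLeaves us} {map nLeaves vs} {map nLeaves ws}
        (cmpForest-lt-trans us vs ws)

    cmpForest-lt-trans : ∀ us vs ws →
      cmpForest us vs ≡ lt → cmpForest vs ws ≡ lt → cmpForest us ws ≡ lt
    cmpForest-lt-trans []       []       []       ()
    cmpForest-lt-trans []       (_ ∷ _)  []       _ ()
    cmpForest-lt-trans []       _        (_ ∷ _)  _ _ = refl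
    cmpForest-lt-trans (u ∷ us) (v ∷ vs) (w ∷ ws) =
      thenC-lt-trans cmpTree (cmpTree-eq⇒≡ u v) (cmpTree-eq⇒≡ v w) (cmpTree-lt-trans u v w)
        (cmpForest-lt-trans us vs ws)

cmpTree-isComparison : IsComparison cmpTree
cmpTree-isComparison = record
  { eq⇒≡     = cmpTree-eq⇒≡ _ _
  ; flips    = cmpTree-flips
  ; lt-trans = λ {u} {v} {w} → cmpTree-lt-trans u v w
  }

open SortBy cmpTree-isComparison using (sortBy-↭-invariant; sortBy-of-sorted)

mutual
  canonical : Tree → Tree
  canonical leaf      = leaf
  canonical (node ts) = node (sortBy cmpTree (canonicals ts))

  canonicals : List Tree → List Tree
  canonicals []       = []
  canonicals (t ∷ ts) = canonical t ∷ canonicals ts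

canonicals≗map : ∀ ts → canonicals ts ≡ map canonical ts
canonicals≗map []       = refl
canonicals≗map (t ∷ ts) = cong (canonical t ∷_) (canonicals≗map ts)

mutual
  nLeaves-canonical : ∀ t → nLeaves (canonical t) ≡ nLeaves t
  nLeaves-canonical leaf      = refl
  nLeaves-canonical (node ts) =
    trans (nLeavesL-↭ (sortBy-↭ cmpTree (canonicals ts))) (nLeavesL-canonicals ts)

  nLeavesL-canonicals : ∀ ts → nLeavesL (canonicals ts) ≡ nLeavesL ts
  nLeavesL-canonicals []       = refl
  nLeavesL-canonicals (t ∷ ts) = cong₂ _+_ (nLeaves-canonical t) (nLeavesL-canonicals ts)

map-nLeaves-canonical : ∀ ts → map nLeaves (map canonical ts) ≡ map nLeaves ts
map-nLeaves-canonical ts = trans (sym (map-∘ ts)) (map-cong nLeaves-canonical ts)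

canonicals-↭ : ∀ {vs us} → vs ↭ us → canonicals vs ↭ canonicals us
canonicals-↭ {vs} {us} vs↭us =
  subst₂ _↭_ (sym (canonicals≗map vs)) (sym (canonicals≗map us)) (map⁺ canonical vs↭us)

mutual
  canonical-≅ : ∀ {v w} → v ≅ w → canonical v ≡ canonical w
  canonical-≅ leaf = refl
  canonical-≅ (node {ts} {vs} {us} ts≅vs vs↭us) = cong node (begin
    sortBy cmpTree (canonicals ts) ≡⟨ cong (sortBy cmpTree) (canonicals-≅ ts≅vs) ⟩
    sortBy cmpTree (canonicals vs) ≡⟨ sortBy-↭-invariant (canonicals-↭ vs↭us) ⟩
    sortBy cmpTree (canonicals us) ∎)
    where open ≡-Reasoning

  canonicals-≅ : ∀ {ts vs} → Pointwise _≅_ ts vs → canonicals ts ≡ canonicals vs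
  canonicals-≅ []              = refl
  canonicals-≅ (t≅v ∷ ts≅vs) = cong₂ _∷_ (canonical-≅ t≅v) (canonicals-≅ ts≅vs)

cmpF-unfold : ∀ f v w → cmpF f v w ≡ thenC (cmpℕ (nLeaves v) (nLeaves w)) (sameSize f v w)
cmpF-unfold f v w with cmpℕ (nLeaves v) (nLeaves w)
... | lt = refl
... | eq = refl
... | gt = refl

sameSize-unfold : ∀ f vs ws → sameSize (suc f) (node vs) (node ws) ≡
  thenC (lexℕ (map nLeaves (sortBy (cmpF f) vs)) (map nLeaves (sortBy (cmpF f) ws)))
        (lexWith (cmpF f) (sortBy (cmpF f) vs) (sortBy (cmpF f) ws))
sameSize-unfold f vs ws
  with lexℕ (map nLeaves (sortBy (cmpF f) vs)) (map nLeaves (sortBy (cmpF f) ws))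
... | lt = refl
... | eq = refl
... | gt = refl

Bounded : ℕ → Tree → Set
Bounded f t = InT t × nLeaves t ≤ f

children-bounded : ∀ {f ts} → InT (node ts) → nLeavesL ts ≤ suc f → All (Bounded f) ts
children-bounded i@(node _ its) ≤f =
  All.zip (its , All.map (λ t< → m<1+n⇒m≤n (<-≤-trans t< ≤f)) (nLeaves-child< i))

module _ {f : ℕ}
         (agrees : ∀ {x y} → Bounded f x → Bounded f y →
                   cmpF f x y ≡ cmpTree (canonical x) (canonical y)) where

  canonical-sortBy : ∀ {ts} → All (Bounded f) ts →
    sortBy cmpTree (canonicals ts) ≡ map canonical (sortBy (cmpF f) ts)
  canonical-sortBy {ts} bts =
    trans (cong (sortBy cmpTree) (canonicals≗map ts)) (sym (sortBy-map canonical agrees bts))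

  sameSize-node-canonical : ∀ {vs ws} → All (Bounded f) vs → All (Bounded f) ws →
    sameSize (suc f) (node vs) (node ws) ≡ cmpShape (canonical (node vs)) (canonical (node ws))
  sameSize-node-canonical {vs} {ws} bvs bws = begin
      sameSize (suc f) (node vs) (node ws)
    ≡⟨ sameSize-unfold f vs ws ⟩
      thenC (lexℕ (map nLeaves V) (map nLeaves W)) (lexWith (cmpF f) V W)
    ≡⟨ cong₂ thenC
         (cong₂ lexℕ (sym (map-nLeaves-canonical V)) (sym (map-nLeaves-canonical W)))
         (trans (lexWith-map canonical {d = cmpTree} agrees (All-sortBy bvs) (All-sortBy bws))
                (sym (cmpForest≗lexWith (map canonical V) (map canonical W)))) ⟩
      thenC (lexℕ (map nLeaves (map canonical V)) (map nLeaves (map canonical W)))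
            (cmpForest (map canonical V) (map canonical W))
    ≡⟨ cong₂ (λ X Y → cmpShape (node X) (node Y)) (canonical-sortBy bvs) (canonical-sortBy bws) ⟨
      cmpShape (canonical (node vs)) (canonical (node ws))
    ∎
    where
      open ≡-Reasoning
      V W : List Tree
      V = sortBy (cmpF f) vs
      W = sortBy (cmpF f) ws

cmpF-canonical : ∀ f {v w} → InT v → InT w → nLeaves v ≤ f →
  cmpF f v w ≡ cmpTree (canonical v) (canonical w)
cmpF-canonical zero    iv _  ≤f with <-≤-trans (0<nLeaves iv) ≤f
... | ()
cmpF-canonical (suc f) {v} {w} iv iw ≤f = begin
    cmpF (suc f) v w
  ≡⟨ cmpF-unfold (suc f) v w ⟩
    thenC (cmpℕ (nLeaves v) (nLeaves w)) (sameSize (suc f) v w)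
  ≡⟨ thenC-congʳ (cmpℕ (nLeaves v) (nLeaves w)) (λ e → sameSize-canonical iv iw ≤f (cmpℕ-eq⇒≡ e)) ⟩
    thenC (cmpℕ (nLeaves v) (nLeaves w)) (cmpShape (canonical v) (canonical w))
  ≡⟨ cong₂ (λ m n → thenC (cmpℕ m n) (cmpShape (canonical v) (canonical w)))
           (nLeaves-canonical v) (nLeaves-canonical w) ⟨
    cmpTree (canonical v) (canonical w)
  ∎
  where
    open ≡-Reasoning
    cmpℕ-eq⇒≡ : ∀ {m n} → cmpℕ m n ≡ eq → m ≡ n
    cmpℕ-eq⇒≡ = IsComparison.eq⇒≡ cmpℕ-isComparison
    IH : ∀ {x y} → Bounded f x → Bounded f y → cmpF f x y ≡ cmpTree (canonical x) (canonical y)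
    IH (ix , x≤f) (iy , _) = cmpF-canonical f ix iy x≤f
    sameSize-canonical : ∀ {v w} → InT v → InT w → nLeaves v ≤ suc f → nLeaves v ≡ nLeaves w →
      sameSize (suc f) v w ≡ cmpShape (canonical v) (canonical w)
    sameSize-canonical leaf          leaf          _  _ = refl
    sameSize-canonical leaf          iw@(node _ _) _  e = ⊥-elim (<-irrefl e (1<nLeaves-node iw))
    sameSize-canonical iv@(node _ _) leaf          _  e =
      ⊥-elim (<-irrefl (sym e) (1<nLeaves-node iv))
    sameSize-canonical iv@(node _ _) iw@(node _ _) ≤f e = sameSize-node-canonical IH
      (children-bounded iv ≤f) (children-bounded iw (subst (_≤ suc f) e ≤f))

compareT-canonical : ∀ {v w} → InT v → InT w → compareT v w ≡ cmpTree (canonical v) (canonical w)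
compareT-canonical {v} iv iw = cmpF-canonical (nLeaves v) iv iw ≤-refl

canonicals-fixed : ∀ {ts} → All (λ t → canonical t ≡ t) ts → canonicals ts ≡ ts
canonicals-fixed []       = refl
canonicals-fixed (e ∷ es) = cong₂ _∷_ e (canonicals-fixed es)

mutual
  canonical-of-ordered : ∀ {t} → InT t → Ordered t → canonical t ≡ t
  canonical-of-ordered leaf leaf = refl
  canonical-of-ordered (node _ its) (node {ts} ots ts↗) = cong node (begin
      sortBy cmpTree (canonicals ts)
    ≡⟨ cong (sortBy cmpTree) (canonicals-fixed fixed) ⟩
      sortBy cmpTree ts
    ≡⟨ sortBy-of-sorted (Linked-map-All ≤T⇒≼ (All.zip (its , fixed)) ts↗) ⟩
      ts
    ∎)
    where
      open ≡-Reasoning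
      fixed : All (λ t → canonical t ≡ t) ts
      fixed = canonical-of-ordered-all its ots
      ≤T⇒≼ : ∀ {a b} → InT a × canonical a ≡ a → InT b × canonical b ≡ b → a ≤T b → cmpTree a b ≢ gt
      ≤T⇒≼ (ia , ca) (ib , cb) a≤b e =
        a≤b (trans (compareT-canonical ia ib) (trans (cong₂ cmpTree ca cb) e))

  canonical-of-ordered-all : ∀ {ts} → All InT ts → All Ordered ts → All (λ t → canonical t ≡ t) ts
  canonical-of-ordered-all []         []         = []
  canonical-of-ordered-all (it ∷ its) (ot ∷ ots) =
    canonical-of-ordered it ot ∷ canonical-of-ordered-all its ots

proposition1 : ∀ {n : ℕ} (G : Graph n) → Cograph G → (C : CoTree n) → IsCotree G C →
    (T U : Tree) → OrderedTree T → OrderedTree U →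
    T ≅ forget C → U ≅ forget C → T ≡ U
-- Only the underlying tree of the cotree matters.
proposition1 _ _ C _ T U (iT , oT) (iU , oU) T≅C U≅C = begin
  T                    ≡⟨ canonical-of-ordered iT oT ⟨
  canonical T          ≡⟨ canonical-≅ T≅C ⟩
  canonical (forget C) ≡⟨ canonical-≅ U≅C ⟨
  canonical U          ≡⟨ canonical-of-ordered iU oU ⟩
  U                    ∎
  where open ≡-Reasoning
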